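{- Let $P$ be a finite poset of dimension $d$. There exists a constant $c_{P}$ such that for every positive integer $m$, if a set $S\subset[m]^{d}$ does not contain a copy of $P$, then $|S|\leq c_{P}m^{d-1}$.
   Context: $[m]=\{1,\dots,m\}$, and $[m]^{d}$ is ordered pointwise: $(x_{1},\dots,x_{d})\leq(y_{1},\dots,y_{d})$ iff $x_{i}\leq y_{i}$ for all $i$. A subset $P'$ of a poset $Q$ is a copy of $P$ if the subposet of $Q$ induced on $P'$ is isomorphic to $P$. The (Dushnik–Miller) dimension of $P$ is the smallest positive integer $d$ such that there exist bijections $L_{1},\dots,L_{d}:P\to[|P|]$ with $p\leq_{P}q$ iff $L_{i}(p)\leq L_{i}(q)$ for all $i\in[d]$. -}

module Defs where

open import Data.Nat using (ℕ; _≤_)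
open import Data.Fin using (Fin)
import Data.Fin as F
open import Data.Vec using (Vec; lookup)
open import Data.List using (List)
open import Data.List.Membership.Propositional using (_∈_)
open import Data.Product using (Σ; _×_)
open import Function.Bundles using (_⤖_; Bijection; _⇔_)
open import Function.Definitions using (Injective)
open import Relation.Binary.PropositionalEquality using (_≡_)

-- A finite poset P is represented on the carrier Fin n (n = |P|) with an
-- order relation _≤P_ satisfying IsPartialOrder _≡_ _≤P_ (see Statement).

Realizer : (n : ℕ) → (Fin n → Fin n → Set) → ℕ → Set
Realizer n _≤P_ d =
  Σ (Fin d → Fin n ⤖ Fin n) λ L →
    ∀ p q → (p ≤P q) ⇔ (∀ i → Bijection.to (L i) p F.≤ Bijection.to (L i) q)

Dimension : (n : ℕ) → (Fin n → Fin n → Set) → ℕ → Set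
Dimension n _≤P_ d =
  (1 ≤ d) × Realizer n _≤P_ d × (∀ d' → 1 ≤ d' → Realizer n _≤P_ d' → d ≤ d')

-- Points of [m]^d are vectors of length d over Fin m (Fin m ≅ [m] order-preservingly);
-- pointwise (product) order.
_≤ᵖ_ : ∀ {m d} → Vec (Fin m) d → Vec (Fin m) d → Set
x ≤ᵖ y = ∀ i → lookup x i F.≤ lookup y i

ContainsCopy : (n : ℕ) → (Fin n → Fin n → Set) → ∀ {m d} → List (Vec (Fin m) d) → Set
ContainsCopy n _≤P_ {m} {d} S =
  Σ (Fin n → Vec (Fin m) d) λ f →
    Injective _≡_ _≡_ f × (∀ p → f p ∈ S) × (∀ p q → (p ≤P q) ⇔ (f p ≤ᵖ f q))

-- A realizer L₁, …, L_d turns any k = |P| points of S that are ordered, strictly in every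
-- coordinate a, like L_a into a copy of P; so it suffices to bound point sets avoiding such a
-- pattern σ, for arbitrary σ : [d] → [k] → [k]. This is done by the Marcus–Tardos block argument
-- and induction on d. Cut the grid into blocks of side s. A block in which every coordinate
-- shows fewer than k residues mod s holds at most (k-1)^d points. Otherwise it is heavy in some
-- direction i, with a set W of at least k residues there. Heavy blocks sharing i, their i-th
-- block coordinate and W, with coordinate i forgotten, avoid σ restricted to the other
-- coordinates: a pattern among them lifts to S, ordering coordinate i by k residues from W
-- and the other coordinates by blocks. By induction each of the d·t·2^s classes has
-- O(t^(d-2)) blocks, and the set of blocks itself avoids σ, so
-- f(s t) ≤ (k-1)^d f(t) + O(t^(d-1)), which for s > (k-1)^d gives f(m) = O(m^(d-1)).

module Submission where

open import Defs
open import Data.Nat using (ℕ; zero; suc; _+_; _*_; _^_; _∸_; _≤_; _<_; z≤n; s≤s; pred; NonZero; _≤?_; _<?_; _/_; _%_)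
open import Data.Nat.DivMod using (m≡m%n+[m/n]*n; /-monoˡ-≤; m<n*o⇒m/o<n; m%n<n)
open import Data.Nat.Properties
open import Data.Fin as F using (Fin; toℕ)
import Data.Fin.Properties as FP
open import Data.Vec as V using (Vec; lookup; removeAt; insertAt)
import Data.Vec.Properties as VP
open import Data.List using (List; []; _∷_; length; map; filter; _++_; upTo; allFin; cartesianProductWith; cartesianProduct; deduplicate)
import Data.List.Properties as LP
open import Data.List.Membership.Propositional using (_∈_; _─_; find)
open import Data.List.Membership.Propositional.Properties
open import Data.Nat.ListAction using (sum)
open import Data.List.Relation.Binary.Subset.Propositional using (_⊆_)
import Data.List.Relation.Unary.Any as Any
open Any using (here; there; any?)
import Data.List.Relation.Unary.All as All
import Data.List.Relation.Unary.All.Properties as All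
open import Data.List.Relation.Unary.Unique.Propositional using (Unique; []; _∷_)
import Data.List.Relation.Unary.Unique.Propositional.Properties as Unique
open import Data.List.Relation.Unary.Unique.DecPropositional.Properties using (deduplicate-!)
open import Data.List.Extrema.Nat using (min; min≤⊤; min≤xs; argmin-sel)
open import Data.Product using (Σ; _×_; _,_; proj₁; proj₂)
open import Data.Sum using (inj₁; inj₂)
open import Data.Empty using (⊥-elim)
open import Relation.Nullary using (¬_; yes; no; _×-dec_)
open import Relation.Unary using (Pred; Decidable)
open import Level using (0ℓ)
open import Relation.Binary.PropositionalEquality
open import Relation.Binary.Definitions using (DecidableEquality)
open import Function using (_∘_; case_of_)
open import Function.Bundles using (Bijection; Equivalence; _⇔_; mk⇔)
open import Relation.Binary.Structures using (IsPartialOrder)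
open import Data.Nat.Tactic.RingSolver using (solve-∀)

private
  variable
    A B Z : Set

∈-─⁺ : ∀ {x z} {ys : List A} → z ∈ ys → (x∈ys : x ∈ ys) → z ≢ x → z ∈ ys ─ x∈ys
∈-─⁺ (here refl) (here refl) z≢x = ⊥-elim (z≢x refl)
∈-─⁺ (here refl) (there _)   _   = here refl
∈-─⁺ (there z∈)  (here refl) _   = z∈
∈-─⁺ (there z∈)  (there x∈)  z≢x = there (∈-─⁺ z∈ x∈ z≢x)

Unique⇒length≤ : {xs ys : List A} → Unique xs → xs ⊆ ys → length xs ≤ length ys
Unique⇒length≤ {xs = []} _ _ = z≤n
Unique⇒length≤ {xs = x ∷ xs} {ys} (x∉xs ∷ xs!) xs⊆ys = begin
  suc (length xs)                     ≤⟨ s≤s (Unique⇒length≤ xs! xs⊆ys─x) ⟩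
  suc (length (ys ─ x∈ys))            ≡⟨ LP.length-removeAt′ ys _ ⟨
  length ys                           ∎
  where
  open ≤-Reasoning
  x∈ys = xs⊆ys (here refl)
  xs⊆ys─x : xs ⊆ ys ─ x∈ys
  xs⊆ys─x z∈xs = ∈-─⁺ (xs⊆ys (there z∈xs)) x∈ys λ { refl → All.lookup x∉xs z∈xs refl }

map⁺-injectiveOn : (f : A → B) {xs : List A} → (∀ {x y} → x ∈ xs → y ∈ xs → f x ≡ f y → x ≡ y) →
                   Unique xs → Unique (map f xs)
map⁺-injectiveOn f {[]} _ [] = []
map⁺-injectiveOn f {x ∷ xs} inj (x∉xs ∷ xs!) =
  All.map⁺ (All.tabulate λ {y} y∈xs fx≡fy → All.lookup x∉xs y∈xs (inj (here refl) (there y∈xs) fx≡fy))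
  ∷ map⁺-injectiveOn f (λ x∈ y∈ → inj (there x∈) (there y∈)) xs!

sum-mono : (xs : List A) {f g : A → ℕ} → (∀ x → f x ≤ g x) → sum (map f xs) ≤ sum (map g xs)
sum-mono []       f≤g = z≤n
sum-mono (x ∷ xs) f≤g = +-mono-≤ (f≤g x) (sum-mono xs f≤g)

∈⇒≤sum : (f : A → ℕ) {x : A} {xs : List A} → x ∈ xs → f x ≤ sum (map f xs)
∈⇒≤sum f {xs = y ∷ xs} (here refl) = m≤m+n (f y) _
∈⇒≤sum f {xs = y ∷ xs} (there x∈) = ≤-trans (∈⇒≤sum f x∈) (m≤n+m _ (f y))

sum≤length* : (f : A → ℕ) (xs : List A) {b : ℕ} → (∀ {x} → x ∈ xs → f x ≤ b) → sum (map f xs) ≤ length xs * b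
sum≤length* f []       f≤b = z≤n
sum≤length* f (x ∷ xs) f≤b = +-mono-≤ (f≤b (here refl)) (sum≤length* f xs (f≤b ∘ there))

sum-split : {P : Pred A 0ℓ} (P? : Decidable P) (f : A → ℕ) (xs : List A) {lo hi : ℕ} →
            (∀ {x} → x ∈ xs → ¬ P x → f x ≤ lo) → (∀ {x} → x ∈ xs → P x → f x ≤ hi) →
            sum (map f xs) ≤ length xs * lo + length (filter P? xs) * hi
sum-split P? f [] _ _ = z≤n
sum-split P? f (x ∷ xs) {lo} {hi} ≤lo ≤hi with P? x
... | yes px = begin
  f x + sum (map f xs)            ≤⟨ +-mono-≤ (≤hi (here refl) px) ih ⟩
  hi + (length xs * lo + n * hi)  ≤⟨ ≤-reflexive (rearrange hi (length xs * lo) (n * hi)) ⟩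
  length xs * lo + (hi + n * hi)  ≤⟨ +-monoˡ-≤ (hi + n * hi) (m≤n+m (length xs * lo) lo) ⟩
  (lo + length xs * lo) + (hi + n * hi) ∎
  where
  open ≤-Reasoning
  n = length (filter P? xs)
  ih = sum-split P? f xs (≤lo ∘ there) (≤hi ∘ there)
  rearrange : ∀ a b c → a + (b + c) ≡ b + (a + c)
  rearrange = solve-∀
... | no ¬px = begin
  f x + sum (map f xs)                   ≤⟨ +-mono-≤ (≤lo (here refl) ¬px) ih ⟩
  lo + (length xs * lo + n * hi)         ≡⟨ +-assoc lo _ _ ⟨
  (lo + length xs * lo) + n * hi         ∎
  where
  open ≤-Reasoning
  n = length (filter P? xs)
  ih = sum-split P? f xs (≤lo ∘ there) (≤hi ∘ there)

sum-<-at : {f g : A → ℕ} {x : A} {xs : List A} → x ∈ xs → (∀ y → f y ≤ g y) → f x < g x →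
           sum (map f xs) < sum (map g xs)
sum-<-at {f = f} {g} {xs = y ∷ xs} (here refl) f≤g fx<gx = +-mono-<-≤ fx<gx (sum-mono xs f≤g)
sum-<-at {f = f} {g} {xs = y ∷ xs} (there x∈) f≤g fx<gx = +-mono-≤-< (f≤g y) (sum-<-at x∈ f≤g fx<gx)

length≤sum-cover : {P : B → Pred A 0ℓ} (P? : ∀ κ → Decidable (P κ)) (xs : List A) (κs : List B) →
                   (∀ {x} → x ∈ xs → Σ B λ κ → κ ∈ κs × P κ x) →
                   length xs ≤ sum (map (λ κ → length (filter (P? κ) xs)) κs)
length≤sum-cover P? []       κs covered = z≤n
length≤sum-cover {P = P} P? (x ∷ xs) κs covered =
  ≤-trans (s≤s (length≤sum-cover P? xs κs (covered ∘ there)))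
          (sum-<-at (proj₁ (proj₂ (covered (here refl)))) grows (grows-at-cover (proj₂ (proj₂ (covered (here refl))))))
  where
  grows : ∀ κ → length (filter (P? κ) xs) ≤ length (filter (P? κ) (x ∷ xs))
  grows κ with P? κ x
  ... | yes _ = n≤1+n _
  ... | no  _ = ≤-refl
  grows-at-cover : ∀ {κ} → P κ x → length (filter (P? κ) xs) < length (filter (P? κ) (x ∷ xs))
  grows-at-cover {κ} Pκx with P? κ x
  ... | yes _    = ≤-refl
  ... | no ¬Pκx = ⊥-elim (¬Pκx Pκx)

length-cartesianProductWith : (f : A → B → Z) (xs : List A) (ys : List B) →
                              length (cartesianProductWith f xs ys) ≡ length xs * length ys
length-cartesianProductWith f []       ys = refl
length-cartesianProductWith f (x ∷ xs) ys = begin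
  length (map (f x) ys ++ cartesianProductWith f xs ys)       ≡⟨ LP.length-++ (map (f x) ys) ⟩
  length (map (f x) ys) + length (cartesianProductWith f xs ys) ≡⟨ cong₂ _+_ (LP.length-map (f x) ys) (length-cartesianProductWith f xs ys) ⟩
  length ys + length xs * length ys                            ∎
  where open ≡-Reasoning

grid : ∀ d → (Fin d → List A) → List (Vec A d)
grid zero    W = V.[] ∷ []
grid (suc d) W = cartesianProductWith V._∷_ (W F.zero) (grid d (W ∘ F.suc))

∈-grid : ∀ {d} (W : Fin d → List A) {x : Vec A d} → (∀ i → lookup x i ∈ W i) → x ∈ grid d W
∈-grid {d = zero}  W {V.[]}    _  = here refl
∈-grid {d = suc d} W {a V.∷ x} x∈ = ∈-cartesianProductWith⁺ V._∷_ (x∈ F.zero) (∈-grid (W ∘ F.suc) (x∈ ∘ F.suc))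

length-grid≤ : ∀ d (W : Fin d → List A) {b : ℕ} → (∀ i → length (W i) ≤ b) → length (grid d W) ≤ b ^ d
length-grid≤ zero    W _  = ≤-refl
length-grid≤ (suc d) W W≤b = ≤-trans (≤-reflexive (length-cartesianProductWith V._∷_ (W F.zero) _))
  (*-mono-≤ (W≤b F.zero) (length-grid≤ d (W ∘ F.suc) (W≤b ∘ F.suc)))

Unique-inGrid⇒length≤ : ∀ {d} (W : Fin d → List A) {b : ℕ} {xs : List (Vec A d)} → Unique xs →
                        (∀ {x} → x ∈ xs → ∀ i → lookup x i ∈ W i) → (∀ i → length (W i) ≤ b) → length xs ≤ b ^ d
Unique-inGrid⇒length≤ {d = d} W xs! xs∈ W≤b = ≤-trans (Unique⇒length≤ xs! (∈-grid W ∘ xs∈)) (length-grid≤ d W W≤b)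

sublists : List A → List (List A)
sublists []       = [] ∷ []
sublists (x ∷ xs) = map (x ∷_) (sublists xs) ++ sublists xs

length-sublists : (xs : List A) → length (sublists xs) ≡ 2 ^ length xs
length-sublists []       = refl
length-sublists (x ∷ xs) = begin
  length (map (x ∷_) (sublists xs) ++ sublists xs)      ≡⟨ LP.length-++ (map (x ∷_) (sublists xs)) ⟩
  length (map (x ∷_) (sublists xs)) + length (sublists xs) ≡⟨ cong (_+ length (sublists xs)) (LP.length-map (x ∷_) (sublists xs)) ⟩
  length (sublists xs) + length (sublists xs)            ≡⟨ cong₂ _+_ (length-sublists xs) (trans (length-sublists xs) (sym (+-identityʳ _))) ⟩
  2 ^ length xs + (2 ^ length xs + 0)                    ∎
  where open ≡-Reasoning

filter∈sublists : {P : Pred A 0ℓ} (P? : Decidable P) (xs : List A) → filter P? xs ∈ sublists xs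
filter∈sublists P? []       = here refl
filter∈sublists P? (x ∷ xs) with P? x
... | yes _ = ∈-++⁺ˡ (∈-map⁺ (x ∷_) (filter∈sublists P? xs))
... | no  _ = ∈-++⁺ʳ (map (x ∷_) (sublists xs)) (filter∈sublists P? xs)

IncreasingIn : ∀ {k} → List ℕ → (Fin k → ℕ) → Set
IncreasingIn xs h = (∀ j → h j ∈ xs) × (∀ i j → toℕ i < toℕ j → h i < h j)

increasingSelection : ∀ k (xs : List ℕ) → Unique xs → k ≤ length xs → Σ (Fin k → ℕ) (IncreasingIn xs)
increasingSelection zero    xs       _  _         = (λ ()) , (λ ()) , (λ ())
increasingSelection (suc k) (x ∷ xs) xs! (s≤s k≤) = h , h∈ , h-increasing
  where
  μ = min x xs
  μ∈ : μ ∈ x ∷ xs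
  μ∈ with argmin-sel (λ y → y) x xs
  ... | inj₁ μ≡x  = here μ≡x
  ... | inj₂ μ∈xs = there μ∈xs
  μ≤ : ∀ {z} → z ∈ x ∷ xs → μ ≤ z
  μ≤ (here refl) = min≤⊤ x xs
  μ≤ (there z∈)  = All.lookup (min≤xs x xs) z∈
  above = filter (μ <?_) (x ∷ xs)
  ⊆μ∷above : x ∷ xs ⊆ μ ∷ above
  ⊆μ∷above z∈ with m≤n⇒m<n∨m≡n (μ≤ z∈)
  ... | inj₁ μ<z = there (∈-filter⁺ (μ <?_) z∈ μ<z)
  ... | inj₂ μ≡z = here (sym μ≡z)
  rest = increasingSelection k above (Unique.filter⁺ (μ <?_) xs!)
           (≤-pred (≤-trans (s≤s k≤) (Unique⇒length≤ xs! ⊆μ∷above)))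
  h : Fin (suc k) → ℕ
  h F.zero    = μ
  h (F.suc j) = proj₁ rest j
  rest∈ : ∀ j → proj₁ rest j ∈ x ∷ xs × μ < proj₁ rest j
  rest∈ j = ∈-filter⁻ (μ <?_) {xs = x ∷ xs} (proj₁ (proj₂ rest) j)
  h∈ : ∀ j → h j ∈ x ∷ xs
  h∈ F.zero    = μ∈
  h∈ (F.suc j) = proj₁ (rest∈ j)
  h-increasing : ∀ i j → toℕ i < toℕ j → h i < h j
  h-increasing F.zero    (F.suc j) _        = proj₂ (rest∈ j)
  h-increasing (F.suc i) (F.suc j) (s≤s i<j) = proj₂ (proj₂ rest) i j i<j

Bounded : ℕ → ∀ {d} → Vec ℕ d → Set
Bounded m x = ∀ i → lookup x i < m

-- σ a j is the position of j in the a-th linear order of a realizer (see realizerPattern).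
Follows : ∀ {d k} → (Fin d → Fin k → Fin k) → (Fin k → Vec ℕ d) → Set
Follows σ g = ∀ a j j' → toℕ (σ a j) < toℕ (σ a j') → lookup (g j) a < lookup (g j') a

Contains : ∀ {d k} → (Fin d → Fin k → Fin k) → List (Vec ℕ d) → Set
Contains {d} {k} σ S = Σ (Fin k → Vec ℕ d) λ g → (∀ j → g j ∈ S) × Follows σ g

Follows-cong : ∀ {d k} {σ : Fin d → Fin k → Fin k} {g g' : Fin k → Vec ℕ d} → g ≗ g' → Follows σ g → Follows σ g'
Follows-cong g≗g' follows a j j' σj<σj' =
  subst₂ (λ x y → lookup x a < lookup y a) (g≗g' j) (g≗g' j') (follows a j j' σj<σj')

AvoidanceBound : ∀ {e k} → (Fin (suc e) → Fin k → Fin k) → ℕ → Set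
AvoidanceBound {e} σ C = ∀ m → 1 ≤ m → (S : List (Vec ℕ (suc e))) → Unique S →
  (∀ {x} → x ∈ S → Bounded m x) → ¬ Contains σ S → length S ≤ C * m ^ e

AvoidanceBound-mono : ∀ {e k} {σ : Fin (suc e) → Fin k → Fin k} {C C'} → C ≤ C' →
                      AvoidanceBound σ C → AvoidanceBound σ C'
AvoidanceBound-mono {e = e} C≤C' bound m m≥1 S S! S<m avoids =
  ≤-trans (bound m m≥1 S S! S<m avoids) (*-monoˡ-≤ (m ^ e) C≤C')

lookup-removeAt : ∀ {n} (x : Vec A (suc n)) (i : Fin (suc n)) (a : Fin n) →
                  lookup (removeAt x i) a ≡ lookup x (F.punchIn i a)
lookup-removeAt x i a = begin
  lookup (removeAt x i) a                                         ≡⟨ cong (lookup (removeAt x i)) (FP.punchOut-punchIn i) ⟨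
  lookup (removeAt x i) (F.punchOut (FP.punchInᵢ≢i i a ∘ sym))    ≡⟨ VP.removeAt-punchOut x _ ⟩
  lookup x (F.punchIn i a)                                        ∎
  where open ≡-Reasoning

Bounded-removeAt : ∀ {m n} {x : Vec ℕ (suc n)} (i : Fin (suc n)) → Bounded m x → Bounded m (removeAt x i)
Bounded-removeAt {m = m} {x = x} i x<m a = subst (_< m) (sym (lookup-removeAt x i a)) (x<m (F.punchIn i a))

removeAt-injective : ∀ {n} {x y : Vec A (suc n)} (i : Fin (suc n)) →
                     removeAt x i ≡ removeAt y i → lookup x i ≡ lookup y i → x ≡ y
removeAt-injective {x = x} {y} i x-i≡y-i xᵢ≡yᵢ = begin
  x                                      ≡⟨ VP.insertAt-removeAt x i ⟨
  insertAt (removeAt x i) i (lookup x i) ≡⟨ cong₂ (λ v a → insertAt v i a) x-i≡y-i xᵢ≡yᵢ ⟩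
  insertAt (removeAt y i) i (lookup y i) ≡⟨ VP.insertAt-removeAt y i ⟩
  y                                      ∎
  where open ≡-Reasoning

Follows-removeAt⇒follows : ∀ {d k} {σ : Fin (suc d) → Fin k → Fin k} {g : Fin k → Vec ℕ (suc d)} (i : Fin (suc d)) →
  Follows (σ ∘ F.punchIn i) (λ j → removeAt (g j) i) →
  ∀ {a} → i ≢ a → ∀ j j' → toℕ (σ a j) < toℕ (σ a j') → lookup (g j) a < lookup (g j') a
Follows-removeAt⇒follows {σ = σ} {g} i follows i≢a j j' σj<σj' =
  subst₂ _<_ (VP.removeAt-punchOut (g j) i≢a) (VP.removeAt-punchOut (g j') i≢a)
    (follows (F.punchOut i≢a) j j' (subst (λ b → toℕ (σ b j) < toℕ (σ b j')) (sym (FP.punchIn-punchOut i≢a)) σj<σj'))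

avoidanceBound₁ : ∀ {k} (σ : Fin 1 → Fin k → Fin k) → AvoidanceBound σ k
avoidanceBound₁ {k} σ m _ S S! _ avoids = ≤-trans ≤k (≤-reflexive (sym (*-identityʳ k)))
  where
  head : Vec ℕ 1 → ℕ
  head x = lookup x F.zero
  head-injective : ∀ {x y} → head x ≡ head y → x ≡ y
  head-injective {_ V.∷ V.[]} {_ V.∷ V.[]} refl = refl
  ≤k : length S ≤ k
  ≤k with length S ≤? k
  ... | yes S≤k = S≤k
  ... | no  S≰k = ⊥-elim (avoids (g , g∈ , g-follows))
    where
    selection = increasingSelection k (map head S) (Unique.map⁺ head-injective S!)
                  (≤-trans (<⇒≤ (≰⇒> S≰k)) (≤-reflexive (sym (LP.length-map head S))))
    h = proj₁ selection
    preimage : ∀ j → Σ (Vec ℕ 1) λ x → x ∈ S × h (σ F.zero j) ≡ head x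
    preimage j = ∈-map⁻ head (proj₁ (proj₂ selection) (σ F.zero j))
    g : Fin k → Vec ℕ 1
    g j = proj₁ (preimage j)
    g∈ : ∀ j → g j ∈ S
    g∈ j = proj₁ (proj₂ (preimage j))
    g-follows : Follows σ g
    g-follows F.zero j j' σj<σj' =
      subst₂ _<_ (proj₂ (proj₂ (preimage j))) (proj₂ (proj₂ (preimage j'))) (proj₂ (proj₂ selection) _ _ σj<σj')

_≟ᵥ_ : ∀ {d} → DecidableEquality (Vec ℕ d)
_≟ᵥ_ = VP.≡-dec _≟_

module Blocks (s : ℕ) .{{_ : NonZero s}} where

  block : ∀ {d} → Vec ℕ d → Vec ℕ d
  block = V.map (_/ s)

  lookup-block : ∀ {d} (x : Vec ℕ d) a → lookup (block x) a ≡ lookup x a / s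
  lookup-block x a = VP.lookup-map a (_/ s) x

  /-<⇒< : ∀ {m n} → m / s < n / s → m < n
  /-<⇒< {m} {n} m/s<n/s with m <? n
  ... | yes m<n = m<n
  ... | no  m≮n = ⊥-elim (<⇒≱ m/s<n/s (/-monoˡ-≤ s (≮⇒≥ m≮n)))

  /-≡-%-<⇒< : ∀ {m n} → m / s ≡ n / s → m % s < n % s → m < n
  /-≡-%-<⇒< {m} {n} m/s≡n/s m%s<n%s = begin-strict
    m                    ≡⟨ m≡m%n+[m/n]*n m s ⟩
    m % s + m / s * s    <⟨ +-monoˡ-< (m / s * s) m%s<n%s ⟩
    n % s + m / s * s    ≡⟨ cong (λ q → n % s + q * s) m/s≡n/s ⟩
    n % s + n / s * s    ≡⟨ m≡m%n+[m/n]*n n s ⟨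
    n                    ∎
    where open ≤-Reasoning

  Bounded-block : ∀ {d t} {x : Vec ℕ d} → Bounded (t * s) x → Bounded t (block x)
  Bounded-block {t = t} {x} x<ts a = subst (_< t) (sym (lookup-block x a)) (m<n*o⇒m/o<n (x<ts a))

  blocks : ∀ {d} → List (Vec ℕ d) → List (Vec ℕ d)
  blocks S = deduplicate _≟ᵥ_ (map block S)

  ∈-blocks⁻ : ∀ {d} {S : List (Vec ℕ d)} {b} → b ∈ blocks S → Σ (Vec ℕ d) λ x → x ∈ S × b ≡ block x
  ∈-blocks⁻ {S = S} b∈ = ∈-map⁻ block (∈-deduplicate⁻ _≟ᵥ_ (map block S) b∈)

  Contains-blocks⇒Contains : ∀ {d k} {σ : Fin d → Fin k → Fin k} {S : List (Vec ℕ d)} →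
                             Contains σ (blocks S) → Contains σ S
  Contains-blocks⇒Contains {σ = σ} (g , g∈ , g-follows) = x , x∈ , x-follows
    where
    x = λ j → proj₁ (∈-blocks⁻ (g∈ j))
    x∈ = λ j → proj₁ (proj₂ (∈-blocks⁻ (g∈ j)))
    g≡ : ∀ j a → lookup (g j) a ≡ lookup (x j) a / s
    g≡ j a = trans (cong (λ v → lookup v a) (proj₂ (proj₂ (∈-blocks⁻ (g∈ j))))) (lookup-block (x j) a)
    x-follows : Follows σ x
    x-follows a j j' σj<σj' = /-<⇒< (subst₂ _<_ (g≡ j a) (g≡ j' a) (g-follows a j j' σj<σj'))

  inBlock : ∀ {d} → List (Vec ℕ d) → Vec ℕ d → List (Vec ℕ d)
  inBlock S b = filter (λ x → block x ≟ᵥ b) S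

  residues : ∀ {d} → Fin d → List (Vec ℕ d) → List ℕ
  residues i S = filter (λ r → any? (λ y → lookup y i % s ≟ r) S) (upTo s)

  Unique-residues : ∀ {d} (i : Fin d) (S : List (Vec ℕ d)) → Unique (residues i S)
  Unique-residues i S = Unique.filter⁺ _ (Unique.upTo⁺ s)

  length-residues≤ : ∀ {d} (i : Fin d) (S : List (Vec ℕ d)) → length (residues i S) ≤ s
  length-residues≤ i S = ≤-trans (LP.length-filter _ (upTo s)) (≤-reflexive (LP.length-upTo s))

  residue∈residues : ∀ {d} {i : Fin d} {S : List (Vec ℕ d)} {y} → y ∈ S → lookup y i % s ∈ residues i S
  residue∈residues {i = i} {S} {y} y∈ = ∈-filter⁺ (λ r → any? (λ y → lookup y i % s ≟ r) S)
    (∈-upTo⁺ (m%n<n (lookup y i) s)) (Any.map (λ { refl → refl }) y∈)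

  residue-witness : ∀ {d} {i : Fin d} {S : List (Vec ℕ d)} {r} → r ∈ residues i S →
                    Σ (Vec ℕ d) λ y → y ∈ S × lookup y i % s ≡ r
  residue-witness {i = i} {S} r∈ = find (proj₂ (∈-filter⁻ (λ r → any? (λ y → lookup y i % s ≟ r) S) {xs = upTo s} r∈))

  length-inBlock≤ : ∀ {d} {S : List (Vec ℕ d)} b {n} → Unique S →
                    (∀ i → length (residues i (inBlock S b)) ≤ n) → length (inBlock S b) ≤ n ^ d
  length-inBlock≤ {S = S} b S! residues≤ =
    Unique-inGrid⇒length≤ W (Unique.filter⁺ _ S!) x∈W (λ i → ≤-trans (≤-reflexive (LP.length-map _ (residues i (inBlock S b)))) (residues≤ i))
    where
    W = λ i → map (λ r → lookup b i * s + r) (residues i (inBlock S b))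
    x∈W : ∀ {x} → x ∈ inBlock S b → ∀ i → lookup x i ∈ W i
    x∈W {x} x∈ i = subst (_∈ W i) xᵢ≡ (∈-map⁺ _ (residue∈residues x∈))
      where
      xᵢ≡ : lookup b i * s + lookup x i % s ≡ lookup x i
      xᵢ≡ = begin
        lookup b i * s + lookup x i % s        ≡⟨ cong (λ q → q * s + lookup x i % s) (trans (cong (λ v → lookup v i) (sym (proj₂ (∈-filter⁻ _ {xs = S} x∈)))) (lookup-block x i)) ⟩
        lookup x i / s * s + lookup x i % s    ≡⟨ +-comm _ (lookup x i % s) ⟩
        lookup x i % s + lookup x i / s * s    ≡⟨ m≡m%n+[m/n]*n (lookup x i) s ⟨
        lookup x i                             ∎
        where open ≡-Reasoning

  Contains-lift : ∀ {d k} (σ : Fin (suc d) → Fin k → Fin k) (S : List (Vec ℕ (suc d))) (i : Fin (suc d))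
                  (W : List ℕ) → k ≤ length W → (bs : Fin k → Vec ℕ (suc d)) →
                  (∀ j → residues i (inBlock S (bs j)) ≡ W) → (∀ j j' → lookup (bs j) i ≡ lookup (bs j') i) →
                  Follows (σ ∘ F.punchIn i) (λ j → removeAt (bs j) i) → Contains σ S
  Contains-lift {k = zero}  σ S i W _   bs _  _    _       = (λ ()) , (λ ()) , λ _ ()
  Contains-lift {k = suc k} σ S i W k≤W bs W≡ row≡ follows = g , g∈ , g-follows
    where
    selection = increasingSelection (suc k) W (subst Unique (W≡ F.zero) (Unique-residues i _)) k≤W
    h = proj₁ selection
    witness : ∀ j → Σ (Vec ℕ _) λ y → y ∈ inBlock S (bs j) × lookup y i % s ≡ h (σ i j)
    witness j = residue-witness (subst (h (σ i j) ∈_) (sym (W≡ j)) (proj₁ (proj₂ selection) (σ i j)))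
    g = λ j → proj₁ (witness j)
    g∈inBlock : ∀ j → g j ∈ S × block (g j) ≡ bs j
    g∈inBlock j = ∈-filter⁻ _ {xs = S} (proj₁ (proj₂ (witness j)))
    g∈ = λ j → proj₁ (g∈inBlock j)
    quotient : ∀ j a → lookup (g j) a / s ≡ lookup (bs j) a
    quotient j a = trans (sym (lookup-block (g j) a)) (cong (λ v → lookup v a) (proj₂ (g∈inBlock j)))
    remainder : ∀ j → lookup (g j) i % s ≡ h (σ i j)
    remainder j = proj₂ (proj₂ (witness j))
    g-follows : Follows σ g
    g-follows a j j' σj<σj' with i F.≟ a
    ... | yes refl = /-≡-%-<⇒< (trans (quotient j i) (trans (row≡ j j') (sym (quotient j' i))))
                       (subst₂ _<_ (sym (remainder j)) (sym (remainder j')) (proj₂ (proj₂ selection) _ _ σj<σj'))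
    ... | no  i≢a  = /-<⇒< (subst₂ _<_ (sym (quotient j a)) (sym (quotient j' a))
                       (Follows-removeAt⇒follows {g = bs} i follows i≢a j j' σj<σj'))

module BlockStep {e k : ℕ} (σ : Fin (suc (suc e)) → Fin k → Fin k) {Cmax : ℕ}
                 (bound : ∀ i → AvoidanceBound (σ ∘ F.punchIn i) Cmax)
                 (s : ℕ) .{{_ : NonZero s}} where

  open Blocks s

  D = suc (suc e)

  module _ {t : ℕ} (t≥1 : 1 ≤ t) {S : List (Vec ℕ D)} (S! : Unique S)
           (S<ts : ∀ {x} → x ∈ S → Bounded (t * s) x) (avoids : ¬ Contains σ S) where

    T = blocks S

    Unique-T : Unique T
    Unique-T = deduplicate-! _≟ᵥ_ (map block S)

    T<t : ∀ {b} → b ∈ T → Bounded t b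
    T<t b∈ with x , x∈ , refl ← ∈-blocks⁻ b∈ = Bounded-block {x = x} (S<ts x∈)

    T-avoids : ¬ Contains σ T
    T-avoids = avoids ∘ Contains-blocks⇒Contains

    Heavy : Vec ℕ D → Set
    Heavy b = Σ (Fin D) λ i → k ≤ length (residues i (inBlock S b))

    heavy? : Decidable Heavy
    heavy? b = FP.any? λ i → k ≤? length (residues i (inBlock S b))

    HT = filter heavy? T

    Key = Fin D × ℕ × List ℕ

    InClass : Key → Vec ℕ D → Set
    InClass (i , ℓ , W) b = lookup b i ≡ ℓ × residues i (inBlock S b) ≡ W

    inClass? : ∀ κ → Decidable (InClass κ)
    inClass? (i , ℓ , W) b = (lookup b i ≟ ℓ) ×-dec LP.≡-dec _≟_ (residues i (inBlock S b)) W

    class : Key → List (Vec ℕ D)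
    class κ = filter (inClass? κ) HT

    wide? : Decidable (λ (κ : Key) → k ≤ length (proj₂ (proj₂ κ)))
    wide? (_ , _ , W) = k ≤? length W

    allKeys : List Key
    allKeys = cartesianProduct (allFin D) (cartesianProduct (upTo t) (sublists (upTo s)))

    keys : List Key
    keys = filter wide? allKeys

    length-keys≤ : length keys ≤ D * (t * 2 ^ s)
    length-keys≤ = ≤-trans (LP.length-filter wide? allKeys) (≤-reflexive (begin
      length allKeys
        ≡⟨ length-cartesianProductWith _,_ (allFin D) (cartesianProduct (upTo t) (sublists (upTo s))) ⟩
      length (allFin D) * length (cartesianProduct (upTo t) (sublists (upTo s)))
        ≡⟨ cong₂ _*_ (LP.length-tabulate {n = D} (λ i → i)) (length-cartesianProductWith _,_ (upTo t) (sublists (upTo s))) ⟩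
      D * (length (upTo t) * length (sublists (upTo s)))
        ≡⟨ cong (D *_) (cong₂ _*_ (LP.length-upTo t) (trans (length-sublists (upTo s)) (cong (2 ^_) (LP.length-upTo s)))) ⟩
      D * (t * 2 ^ s) ∎))
      where open ≡-Reasoning

    heavy-covered : ∀ {b} → b ∈ HT → Σ Key λ κ → κ ∈ keys × InClass κ b
    heavy-covered {b} b∈HT with ∈-filter⁻ heavy? {xs = T} b∈HT
    ... | b∈T , (i , wide) = (i , lookup b i , residues i (inBlock S b)) , κ∈keys , refl , refl
      where
      κ∈keys = ∈-filter⁺ wide? (∈-cartesianProduct⁺ (∈-allFin i)
                 (∈-cartesianProduct⁺ (∈-upTo⁺ (T<t b∈T i)) (filter∈sublists _ (upTo s)))) wide

    length-class≤ : ∀ {κ} → κ ∈ keys → length (class κ) ≤ Cmax * t ^ e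
    length-class≤ {κ@(i , ℓ , W)} κ∈keys = begin
      length (class κ)      ≡⟨ LP.length-map project (class κ) ⟨
      length (map project (class κ)) ≤⟨ bound i t t≥1 _ projection! projection<t projection-avoids ⟩
      Cmax * t ^ e          ∎
      where
      open ≤-Reasoning
      project : Vec ℕ D → Vec ℕ (suc e)
      project b = removeAt b i
      class⊆T : ∀ {b} → b ∈ class κ → b ∈ T × InClass κ b
      class⊆T b∈ = let b∈HT , inκ = ∈-filter⁻ (inClass? κ) {xs = HT} b∈ in proj₁ (∈-filter⁻ heavy? {xs = T} b∈HT) , inκ
      projection! : Unique (map project (class κ))
      projection! = map⁺-injectiveOn project
        (λ b∈ b'∈ eq → removeAt-injective i eq (trans (proj₁ (proj₂ (class⊆T b∈))) (sym (proj₁ (proj₂ (class⊆T b'∈))))))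
        (Unique.filter⁺ (inClass? κ) (Unique.filter⁺ heavy? Unique-T))
      projection<t : ∀ {y} → y ∈ map project (class κ) → Bounded t y
      projection<t y∈ with b , b∈ , refl ← ∈-map⁻ project y∈ = Bounded-removeAt {x = b} i (T<t (proj₁ (class⊆T b∈)))
      projection-avoids : ¬ Contains (σ ∘ F.punchIn i) (map project (class κ))
      projection-avoids (g , g∈ , g-follows) =
        avoids (Contains-lift σ S i W (proj₂ (∈-filter⁻ wide? {xs = allKeys} κ∈keys)) bs
                 (λ j → proj₂ (proj₂ (class⊆T (bs∈ j))))
                 (λ j j' → trans (proj₁ (proj₂ (class⊆T (bs∈ j)))) (sym (proj₁ (proj₂ (class⊆T (bs∈ j'))))))
                 (Follows-cong g≡ g-follows))
        where
        bs = λ j → proj₁ (∈-map⁻ project (g∈ j))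
        bs∈ = λ j → proj₁ (proj₂ (∈-map⁻ project (g∈ j)))
        g≡ = λ j → proj₂ (proj₂ (∈-map⁻ project (g∈ j)))

    length-HT≤ : length HT ≤ D * (t * 2 ^ s) * (Cmax * t ^ e)
    length-HT≤ = begin
      length HT                                ≤⟨ length≤sum-cover inClass? HT keys heavy-covered ⟩
      sum (map (length ∘ class) keys)          ≤⟨ sum≤length* (length ∘ class) keys length-class≤ ⟩
      length keys * (Cmax * t ^ e)             ≤⟨ *-monoˡ-≤ (Cmax * t ^ e) length-keys≤ ⟩
      D * (t * 2 ^ s) * (Cmax * t ^ e)         ∎
      where open ≤-Reasoning

    length≤blockRecurrence : length S ≤ length T * pred k ^ D + D * (t * 2 ^ s) * (Cmax * t ^ e) * s ^ D
    length≤blockRecurrence = begin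
      length S                                  ≤⟨ length≤sum-cover (λ b x → block x ≟ᵥ b) S T
                                                     (λ {x} x∈ → block x , ∈-deduplicate⁺ _≟ᵥ_ (∈-map⁺ block x∈) , refl) ⟩
      sum (map (length ∘ inBlock S) T)          ≤⟨ sum-split heavy? (length ∘ inBlock S) T light≤ heavy≤ ⟩
      length T * pred k ^ D + length HT * s ^ D ≤⟨ +-monoʳ-≤ (length T * pred k ^ D) (*-monoˡ-≤ (s ^ D) length-HT≤) ⟩
      length T * pred k ^ D + D * (t * 2 ^ s) * (Cmax * t ^ e) * s ^ D ∎
      where
      open ≤-Reasoning
      light≤ : ∀ {b} → b ∈ T → ¬ Heavy b → length (inBlock S b) ≤ pred k ^ D
      light≤ {b} _ light = length-inBlock≤ b S! λ i → <⇒≤pred (≰⇒> λ wide → light (i , wide))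
      heavy≤ : ∀ {b} → b ∈ T → Heavy b → length (inBlock S b) ≤ s ^ D
      heavy≤ {b} _ _ = length-inBlock≤ b S! λ i → length-residues≤ i (inBlock S b)

*-distrib-^ : ∀ m n o → (m * n) ^ o ≡ m ^ o * n ^ o
*-distrib-^ m n zero    = refl
*-distrib-^ m n (suc o) = trans (cong (m * n *_) (*-distrib-^ m n o)) (interchange m n (m ^ o) (n ^ o))
  where
  interchange : ∀ a b c d → a * b * (c * d) ≡ a * c * (b * d)
  interchange = solve-∀

powerBracket : ∀ s → 2 ≤ s → ∀ m → 1 ≤ m → Σ ℕ λ r → m ≤ s ^ r × s ^ r ≤ s * m
powerBracket s s≥2 1 _ = 0 , ≤-refl , ≤-trans (≤-trans (s≤s z≤n) s≥2) (≤-reflexive (sym (*-identityʳ s)))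
powerBracket s s≥2 (suc (suc m)) _ with powerBracket s s≥2 (suc m) (s≤s z≤n)
... | r , m+1≤s^r , s^r≤s[m+1] with suc (suc m) ≤? s ^ r
...   | yes m+2≤s^r = r , m+2≤s^r , ≤-trans s^r≤s[m+1] (*-monoʳ-≤ s (n≤1+n _))
...   | no  m+2≰s^r = suc r , m+2≤s*s^r , *-monoʳ-≤ s (≤-trans (≤-reflexive s^r≡m+1) (n≤1+n _))
  where
  s^r≡m+1 : s ^ r ≡ suc m
  s^r≡m+1 = ≤-antisym (≤-pred (≰⇒> m+2≰s^r)) m+1≤s^r
  m+2≤s*s^r : suc (suc m) ≤ s * s ^ r
  m+2≤s*s^r = begin
    suc (suc m)      ≤⟨ m≤m+n (suc (suc m)) m ⟩
    suc (suc m) + m  ≡⟨ double m ⟩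
    2 * suc m        ≤⟨ *-monoˡ-≤ (suc m) s≥2 ⟩
    s * suc m        ≡⟨ cong (s *_) s^r≡m+1 ⟨
    s * s ^ r        ∎
    where
    open ≤-Reasoning
    double : ∀ n → suc (suc n) + n ≡ 2 * suc n
    double = solve-∀

recurrence-step : ∀ {nS nT L A s t} e → suc L ≤ s → nT ≤ suc A * t ^ suc e → nS ≤ nT * L + A * t ^ suc e →
                  nS ≤ suc A * (s * t) ^ suc e
recurrence-step {nS} {nT} {L} {A} {s@(suc _)} {t} e L<s nT≤ nS≤ = begin
  nS                               ≤⟨ nS≤ ⟩
  nT * L + A * X                   ≤⟨ +-mono-≤ (*-monoˡ-≤ L nT≤) (*-monoˡ-≤ X (n≤1+n A)) ⟩
  c * X * L + c * X                ≡⟨ collect c X L ⟩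
  c * X * suc L                    ≤⟨ *-monoʳ-≤ (c * X) L<s ⟩
  c * X * s                        ≤⟨ *-monoʳ-≤ (c * X) (m≤m*n s (s ^ e) {{m^n≢0 s e}}) ⟩
  c * X * s ^ suc e                ≡⟨ reorder c X (s ^ suc e) ⟩
  c * (s ^ suc e * X)              ≡⟨ cong (c *_) (*-distrib-^ s t (suc e)) ⟨
  c * (s * t) ^ suc e              ∎
  where
  open ≤-Reasoning
  c = suc A
  X = t ^ suc e
  collect : ∀ c x l → c * x * l + c * x ≡ c * x * suc l
  collect = solve-∀
  reorder : ∀ c x y → c * x * y ≡ c * (y * x)
  reorder = solve-∀

module PowerInduction {e k : ℕ} (σ : Fin (suc (suc e)) → Fin k → Fin k) {Cmax : ℕ}
                      (bound : ∀ i → AvoidanceBound (σ ∘ F.punchIn i) Cmax) where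

  D = suc (suc e)
  L = pred k ^ D
  s = 2 + L
  a = D * 2 ^ s * Cmax * s ^ D
  C = suc a

  open BlockStep σ {Cmax} bound s hiding (D)

  avoidanceBound-pow : ∀ r {S : List (Vec ℕ D)} → Unique S → (∀ {x} → x ∈ S → Bounded (s ^ r) x) →
                       ¬ Contains σ S → length S ≤ C * (s ^ r) ^ suc e
  avoidanceBound-pow zero {S} S! S<1 _ = begin
    length S       ≤⟨ Unique-inGrid⇒length≤ (λ _ → 0 ∷ []) S! (λ x∈ i → only-zero (S<1 x∈ i)) (λ _ → ≤-refl) ⟩
    1 ^ D          ≡⟨ ^-zeroˡ D ⟩
    1              ≤⟨ s≤s z≤n ⟩
    C              ≡⟨ *-identityʳ C ⟨
    C * 1          ≡⟨ cong (C *_) (^-zeroˡ (suc e)) ⟨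
    C * 1 ^ suc e  ∎
    where
    open ≤-Reasoning
    only-zero : ∀ {n} → n < 1 → n ∈ 0 ∷ []
    only-zero (s≤s z≤n) = here refl
  avoidanceBound-pow (suc r) {S} S! S<ss^r avoids =
    recurrence-step {L = L} {A = a} {s = s} {t = s ^ r} e (n≤1+n (suc L)) (avoidanceBound-pow r (Unique-T t≥1 S! S<ts avoids) (T<t t≥1 S! S<ts avoids)
                                         (T-avoids t≥1 S! S<ts avoids))
      (subst (length S ≤_) (cong (length (T t≥1 S! S<ts avoids) * L +_) (step-term (s ^ r)))
        (length≤blockRecurrence t≥1 S! S<ts avoids))
    where
    t≥1 : 1 ≤ s ^ r
    t≥1 = m^n>0 s r
    S<ts : ∀ {x} → x ∈ S → Bounded (s ^ r * s) x
    S<ts {x} x∈ i = subst (lookup x i <_) (*-comm s (s ^ r)) (S<ss^r x∈ i)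
    step-term : ∀ t → D * (t * 2 ^ s) * (Cmax * t ^ e) * s ^ D ≡ D * 2 ^ s * Cmax * s ^ D * t ^ suc e
    step-term t = regroup D t (2 ^ s) Cmax (t ^ e) (s ^ D)
      where
      regroup : ∀ d t p c x q → d * (t * p) * (c * x) * q ≡ d * p * c * q * (t * x)
      regroup = solve-∀

avoidanceBound : ∀ e {k} (σ : Fin (suc e) → Fin k → Fin k) → Σ ℕ (AvoidanceBound σ)
avoidanceBound zero    {k} σ = k , avoidanceBound₁ σ
avoidanceBound (suc e) {k} σ = C * s ^ suc e , bound-all-m
  where
  Cᵢ = λ i → proj₁ (avoidanceBound e (σ ∘ F.punchIn i))
  Cmax = sum (map Cᵢ (allFin (suc (suc e))))
  bound : ∀ i → AvoidanceBound (σ ∘ F.punchIn i) Cmax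
  bound i = AvoidanceBound-mono (∈⇒≤sum Cᵢ (∈-allFin i)) (proj₂ (avoidanceBound e (σ ∘ F.punchIn i)))
  open PowerInduction σ {Cmax} bound
  bound-all-m : AvoidanceBound σ (C * s ^ suc e)
  bound-all-m m m≥1 S S! S<m avoids with r , m≤s^r , s^r≤sm ← powerBracket s (s≤s (s≤s z≤n)) m m≥1 = begin
    length S                   ≤⟨ avoidanceBound-pow r S! (λ x∈ i → <-≤-trans (S<m x∈ i) m≤s^r) avoids ⟩
    C * (s ^ r) ^ suc e        ≤⟨ *-monoʳ-≤ C (^-monoˡ-≤ (suc e) s^r≤sm) ⟩
    C * (s * m) ^ suc e        ≡⟨ cong (C *_) (*-distrib-^ s m (suc e)) ⟩
    C * (s ^ suc e * m ^ suc e) ≡⟨ *-assoc C (s ^ suc e) (m ^ suc e) ⟨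
    C * s ^ suc e * m ^ suc e  ∎
    where open ≤-Reasoning

toℕᵛ : ∀ {m d} → Vec (Fin m) d → Vec ℕ d
toℕᵛ = V.map toℕ

toℕᵛ-injective : ∀ {m d} {x y : Vec (Fin m) d} → toℕᵛ x ≡ toℕᵛ y → x ≡ y
toℕᵛ-injective {x = V.[]}    {V.[]}    _  = refl
toℕᵛ-injective {x = a V.∷ x} {b V.∷ y} eq with a≡b , x≡y ← VP.∷-injective eq =
  cong₂ V._∷_ (FP.toℕ-injective a≡b) (toℕᵛ-injective x≡y)

Bounded-toℕᵛ : ∀ {m d} (x : Vec (Fin m) d) → Bounded m (toℕᵛ x)
Bounded-toℕᵛ {m} x i = subst (_< m) (sym (VP.lookup-map i toℕ x)) (FP.toℕ<n (lookup x i))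

realizerPattern : ∀ {n _≤P_ d} → Realizer n _≤P_ d → Fin d → Fin n → Fin n
realizerPattern (L , _) a = Bijection.to (L a)

Contains⇒ContainsCopy : ∀ {n} {_≤P_ : Fin n → Fin n → Set} {d m} → IsPartialOrder _≡_ _≤P_ →
                        (R : Realizer n _≤P_ d) {S : List (Vec (Fin m) d)} →
                        Contains (realizerPattern R) (map toℕᵛ S) → ContainsCopy n _≤P_ S
Contains⇒ContainsCopy {n} {_≤P_} po R@(L , realizes) {S} (g , g∈ , g-follows) = f , f-injective , f∈ , f-embeds
  where
  σ = realizerPattern R
  preimage = λ p → ∈-map⁻ toℕᵛ (g∈ p)
  f = λ p → proj₁ (preimage p)
  f∈ = λ p → proj₁ (proj₂ (preimage p))
  coordinate : ∀ p a → toℕ (lookup (f p) a) ≡ lookup (g p) a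
  coordinate p a = trans (sym (VP.lookup-map a toℕ (f p))) (cong (λ v → lookup v a) (sym (proj₂ (proj₂ (preimage p)))))
  f-follows : ∀ a {p q} → toℕ (σ a p) < toℕ (σ a q) → lookup (f p) a F.< lookup (f q) a
  f-follows a {p} {q} σp<σq = subst₂ _<_ (sym (coordinate p a)) (sym (coordinate q a)) (g-follows a p q σp<σq)
  monotone : ∀ {p q} → p ≤P q → f p ≤ᵖ f q
  monotone {p} {q} p≤q a with p F.≟ q
  ... | yes refl = ≤-refl
  ... | no  p≢q  = <⇒≤ (f-follows a (≤∧≢⇒< (Equivalence.to (realizes p q) p≤q a)
                                            (p≢q ∘ Bijection.injective (L a) ∘ FP.toℕ-injective)))
  reflecting : ∀ {p q} → f p ≤ᵖ f q → p ≤P q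
  reflecting {p} {q} fp≤fq = Equivalence.from (realizes p q) λ a → ≮⇒≥ λ σq<σp → <⇒≱ (f-follows a σq<σp) (fp≤fq a)
  f-embeds : ∀ p q → (p ≤P q) ⇔ (f p ≤ᵖ f q)
  f-embeds p q = mk⇔ monotone reflecting
  f-injective : ∀ {p q} → f p ≡ f q → p ≡ q
  f-injective fp≡fq = IsPartialOrder.antisym po (reflecting (λ a → FP.≤-reflexive (cong (λ v → lookup v a) fp≡fq)))
                                               (reflecting (λ a → FP.≤-reflexive (cong (λ v → lookup v a) (sym fp≡fq))))

corollary4 : (n : ℕ) (_≤P_ : Fin n → Fin n → Set) → IsPartialOrder _≡_ _≤P_ →
    (d : ℕ) → Dimension n _≤P_ d →
    Σ ℕ λ c → (m : ℕ) → 1 ≤ m → (S : List (Vec (Fin m) d)) → Unique S →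
      ¬ ContainsCopy n _≤P_ S → length S ≤ c * m ^ (d ∸ 1)
corollary4 n _≤P_ po zero    (() , _)
corollary4 n _≤P_ po (suc e) (_ , R , _) with c , bound ← avoidanceBound e (realizerPattern R) =
  c , λ m m≥1 S S! noCopy → begin
    length S              ≡⟨ LP.length-map toℕᵛ S ⟨
    length (map toℕᵛ S)   ≤⟨ bound m m≥1 (map toℕᵛ S) (Unique.map⁺ toℕᵛ-injective S!)
                               (λ x∈ → case ∈-map⁻ toℕᵛ x∈ of λ { (x , _ , refl) → Bounded-toℕᵛ x })
                               (noCopy ∘ Contains⇒ContainsCopy po R) ⟩
    c * m ^ e             ∎
  where open ≤-Reasoning
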